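{- Let $G$ be a finite graph and $S$ a root of $G$. Then for every basis $B$ of an inescapable cofinite subspace of $\mathcal{T}(G,S)$ we have $S=\sum_{p\in B}T(p)$ in the graph monoid $\mathcal{M}(G)$.
   Context: A graph is $G=(V,E,o,t)$ with vertex set $V$, edge set $E$, maps $o,t:E\to V$ (origin, terminus); loops and multiple edges allowed. $E_o(v)=\{e:o(e)=v\}$. A walk is an empty walk $\epsilon_v$ ($O=T=v$) or $e_1\dots e_n$ with $t(e_i)=o(e_{i+1})$, $O=o(e_1)$, $T=t(e_n)$. A root is a vertex from which every vertex is reachable by a walk. The unfolding tree $\mathcal{T}(G,S)$ has vertex set $\mathcal{W}(G,S)$ of walks with origin $S$, and an edge from $w$ to $we$ whenever $e$ is an edge and $we$ a walk. Write $w\le_p w'$ if $w'=wu$ for some walk $u$. A vertex-induced subgraph $\mathcal{S}$ of $\mathcal{T}(G,S)$ is a subspace if $w\in\mathcal{S}$, $w\le_p w'$ imply $w'\in\mathcal{S}$; inescapable if each $w\in\mathcal{W}(G,S)$ has some $w'\in\mathcal{S}$ with $w\le_p w'$; cofinite if there is a finite $F$ with $V\mathcal{S}=\{w:\exists x\in F,\ x\le_p w\}$. The basis of a subspace is the set of its $\le_p$-minimal elements. The graph monoid $\mathcal{M}(G)$ is the commutative monoid generated by $V$ subject to $v=\sum_{e\in E_o(v)}t(e)$ for each $v$ with $E_o(v)\ne\emptyset$. -}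

module Defs where

open import Data.Nat using (ℕ)
open import Data.Fin using (Fin; _≟_)
open import Data.List using (List; []; _∷_; _++_; map; filter; allFin; [_])
open import Data.List.Membership.Propositional using (_∈_)
open import Data.List.Relation.Binary.Permutation.Propositional using (_↭_)
open import Data.Product using (Σ; ∃; _×_)
open import Relation.Binary.PropositionalEquality using (_≡_)
open import Relation.Nullary.Decidable using (does)

record Graph : Set where
  field
    nV : ℕ
    nE : ℕ
    o  : Fin nE → Fin nV
    t  : Fin nE → Fin nV

module _ (G : Graph) where
  open Graph G

  Vertex : Set
  Vertex = Fin nV

  Edge : Set
  Edge = Fin nE

  -- A walk with origin v is represented by its list of edges;
  -- the empty list is the empty walk ε_v.
  data IsWalkFrom : Vertex → List Edge → Set where
    ε    : ∀ {v} → IsWalkFrom v []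
    step : ∀ {v e es} → o e ≡ v → IsWalkFrom (t e) es → IsWalkFrom v (e ∷ es)

  terminus : Vertex → List Edge → Vertex
  terminus v []       = v
  terminus v (e ∷ es) = terminus (t e) es

  IsRoot : Vertex → Set
  IsRoot S = ∀ v → ∃ λ w → IsWalkFrom S w × terminus S w ≡ v

  _≤p_ : List Edge → List Edge → Set
  w ≤p w' = ∃ λ u → w' ≡ w ++ u

  -- A vertex-induced subgraph of T(G,S), given by its vertex set P
  -- (a predicate on walks with origin S).
  IsSubspace : Vertex → (List Edge → Set) → Set
  IsSubspace S P =
    (∀ w → P w → IsWalkFrom S w) ×
    (∀ w w' → IsWalkFrom S w' → P w → w ≤p w' → P w')

  IsInescapable : Vertex → (List Edge → Set) → Set
  IsInescapable S P = ∀ w → IsWalkFrom S w → ∃ λ w' → P w' × w ≤p w'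

  IsCofinite : Vertex → (List Edge → Set) → Set
  IsCofinite S P = ∃ λ (F : List (List Edge)) →
    (∀ x → x ∈ F → IsWalkFrom S x) ×
    (∀ w → IsWalkFrom S w →
       (P w → ∃ λ x → x ∈ F × x ≤p w) × ((∃ λ x → x ∈ F × x ≤p w) → P w))

  InBasis : (List Edge → Set) → List Edge → Set
  InBasis P w = P w × (∀ w' → P w' → w' ≤p w → w' ≡ w)

  Eo : Vertex → List Edge
  Eo v = filter (λ e → o e ≟ v) (allFin nE)

  -- The graph monoid M(G): elements are formal sums of vertices (lists),
  -- modulo the congruence generated by commutativity/associativity and the
  -- relations v = Σ_{e ∈ E_o(v)} t(e) for v with E_o(v) ≠ ∅.
  data _≈M_ : List Vertex → List Vertex → Set where
    ≈-refl  : ∀ {xs} → xs ≈M xs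
    ≈-sym   : ∀ {xs ys} → xs ≈M ys → ys ≈M xs
    ≈-trans : ∀ {xs ys zs} → xs ≈M ys → ys ≈M zs → xs ≈M zs
    ≈-perm  : ∀ {xs ys} → xs ↭ ys → xs ≈M ys
    ≈-++    : ∀ {xs xs' ys ys'} → xs ≈M xs' → ys ≈M ys' → (xs ++ ys) ≈M (xs' ++ ys')
    ≈-rel   : ∀ v → (∃ λ e → o e ≡ v) → [ v ] ≈M map t (Eo v)

{-# OPTIONS --safe #-}
-- Expanding [S] by the defining relation v = Σ t(e) at every vertex reached
-- by a walk outside the subspace rewrites it as the sum of the termini of the
-- walks at which the expansion stops, and those are exactly the minimal walks
-- of the subspace, i.e. the basis. Inescapability provides the outgoing edge
-- needed for each expansion; cofiniteness makes membership decidable and the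
-- expansion finite, since every walk at least as long as all generators lies
-- in the subspace.
module Submission where

open import Defs
open import Data.List using (List; []; _∷_; _++_; [_]; map; concatMap; length; allFin)
open import Data.List.Properties using (∷-injective; ++-assoc; ++-identityʳ; ++-cancelˡ; ++-conicalˡ; length-++; map-concatMap)
open import Data.List.Membership.Propositional using (_∈_; find; lose)
open import Data.List.Membership.Propositional.Properties using (∈-filter⁺; ∈-filter⁻; ∈-allFin; ∈-concatMap⁺; ∈-concatMap⁻)
open import Data.List.Membership.Propositional.Properties.WithK using (unique∧set⇒bag)
open import Data.List.Relation.Binary.BagAndSetEquality using (_∼[_]_; bag; ∼bag⇒↭)
open import Data.List.Relation.Binary.Permutation.Propositional.Properties using () renaming (map⁺ to ↭-map⁺)
open import Data.List.Relation.Unary.All using ([]) renaming (lookup to All-lookup)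
open import Data.List.Relation.Unary.AllPairs using (_∷_)
open import Data.List.Relation.Unary.Any using (Any; here; there; any?)
open import Data.List.Relation.Unary.Unique.Propositional using (Unique; [])
import Data.List.Relation.Unary.Unique.Propositional.Properties as Unique
open import Data.Nat using (ℕ; zero; suc; _+_; _≤_; s≤s)
open import Data.Nat.ListAction using (sum)
open import Data.Nat.Properties using (+-assoc; +-identityʳ; m≤m+n; m≤n+m; ≤-trans; ≤-reflexive)
open import Data.Fin using (_≟_)
open import Data.Product using (_×_; _,_; proj₁; proj₂; ∃)
open import Data.Sum using (_⊎_; inj₁; inj₂)
open import Data.Empty using (⊥; ⊥-elim)
open import Function using (_∘_)
open import Function.Bundles using (mk⇔)
open import Relation.Binary.Definitions using (DecidableEquality)
open import Relation.Nullary using (Dec; yes; no; ¬_)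
open import Relation.Binary.PropositionalEquality using (_≡_; refl; sym; trans; cong; subst; module ≡-Reasoning)

module _ {A : Set} where

  prefix? : DecidableEquality A → ∀ (xs ys : List A) → Dec (∃ λ u → ys ≡ xs ++ u)
  prefix? _≟_ []       ys       = yes (ys , refl)
  prefix? _≟_ (x ∷ xs) []       = no λ ()
  prefix? _≟_ (x ∷ xs) (y ∷ ys) with x ≟ y | prefix? _≟_ xs ys
  ... | no x≢y   | _            = no λ (_ , eq) → x≢y (sym (proj₁ (∷-injective eq)))
  ... | yes refl | no ¬p        = no λ (u , eq) → ¬p (u , proj₂ (∷-injective eq))
  ... | yes refl | yes (u , eq) = yes (u , cong (x ∷_) eq)

  prefixes-comparable : ∀ (xs ys : List A) {as bs} → xs ++ as ≡ ys ++ bs →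
    (∃ λ u → ys ≡ xs ++ u) ⊎ (∃ λ u → xs ≡ ys ++ u)
  prefixes-comparable []       ys       _  = inj₁ (ys , refl)
  prefixes-comparable (x ∷ xs) []       _  = inj₂ (x ∷ xs , refl)
  prefixes-comparable (x ∷ xs) (y ∷ ys) eq with ∷-injective eq
  ... | refl , eq′ with prefixes-comparable xs ys eq′
  ...   | inj₁ (u , p) = inj₁ (u , cong (x ∷_) p)
  ...   | inj₂ (u , p) = inj₂ (u , cong (x ∷_) p)

  prefix-of-∷ʳ : ∀ (u xs : List A) {v} e → xs ++ [ e ] ≡ u ++ v →
    (∃ λ r → xs ≡ u ++ r) ⊎ u ≡ xs ++ [ e ]
  prefix-of-∷ʳ []          xs       _ _  = inj₁ (xs , refl)
  prefix-of-∷ʳ (_ ∷ [])    []       _ eq with ∷-injective eq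
  ... | refl , _ = inj₂ refl
  prefix-of-∷ʳ (_ ∷ _ ∷ _) []       _ ()
  prefix-of-∷ʳ (_ ∷ u)     (x ∷ xs) e eq with ∷-injective eq
  ... | refl , eq′ with prefix-of-∷ʳ u xs e eq′
  ...   | inj₁ (r , p) = inj₁ (r , cong (x ∷_) p)
  ...   | inj₂ p       = inj₂ (cong (x ∷_) p)

  ∷ʳ-extensions-agree : ∀ (w : List A) {e e′} u u′ →
    (w ++ [ e ]) ++ u ≡ (w ++ [ e′ ]) ++ u′ → e ≡ e′
  ∷ʳ-extensions-agree w {e} {e′} u u′ eq = proj₁ (∷-injective (++-cancelˡ w _ _ (begin
    w ++ e ∷ u           ≡⟨ ++-assoc w [ e ] u ⟨
    (w ++ [ e ]) ++ u    ≡⟨ eq ⟩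
    (w ++ [ e′ ]) ++ u′  ≡⟨ ++-assoc w [ e′ ] u′ ⟩
    w ++ e′ ∷ u′         ∎)))
    where open ≡-Reasoning

  extension-no-longer : ∀ (w q : List A) → length (w ++ q) ≤ length w → w ++ q ≡ w
  extension-no-longer []      []      _        = refl
  extension-no-longer (a ∷ w) q       (s≤s le) = cong (a ∷_) (extension-no-longer w q le)

  length≤sum-lengths : ∀ {xs : List A} {xss} → xs ∈ xss → length xs ≤ sum (map length xss)
  length≤sum-lengths                (here refl) = m≤m+n _ _
  length≤sum-lengths {xss = ys ∷ _} (there p) = ≤-trans (length≤sum-lengths p) (m≤n+m _ (length ys))

  concatMap-unique : ∀ {B : Set} (f : A → List B) {xs} → Unique xs →
    (∀ x → Unique (f x)) → (∀ {x y b} → b ∈ f x → b ∈ f y → x ≡ y) →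
    Unique (concatMap f xs)
  concatMap-unique f []                          _        _      = []
  concatMap-unique f {x ∷ xs} (x∉xs ∷ xs-unique) f-unique f-disj =
    Unique.++⁺ (f-unique x) (concatMap-unique f xs-unique f-unique f-disj) disjoint
    where
    disjoint : ∀ {b} → b ∈ f x × b ∈ concatMap f xs → ⊥
    disjoint (b∈fx , b∈rest) with find (∈-concatMap⁻ f {xs = xs} b∈rest)
    ... | y , y∈xs , b∈fy = All-lookup x∉xs y∈xs (f-disj b∈fx b∈fy)

module _ (G : Graph) where
  open Graph G

  terminus-++ : ∀ v (xs ys : List (Edge G)) →
    terminus G v (xs ++ ys) ≡ terminus G (terminus G v xs) ys
  terminus-++ v []       ys = refl
  terminus-++ v (e ∷ xs) ys = terminus-++ (t e) xs ys

  walk-∷ʳ : ∀ {v w e} → IsWalkFrom G v w → o e ≡ terminus G v w → IsWalkFrom G v (w ++ [ e ])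
  walk-∷ʳ ε            oe = step oe ε
  walk-∷ʳ (step oe′ w) oe = step oe′ (walk-∷ʳ w oe)

  walk-next-origin : ∀ {v} u {e r} → IsWalkFrom G v (u ++ e ∷ r) → o e ≡ terminus G v u
  walk-next-origin []      (step oe _) = oe
  walk-next-origin (_ ∷ u) (step _ w)  = walk-next-origin u w

  ∈-Eo⁺ : ∀ {v e} → o e ≡ v → e ∈ Eo G v
  ∈-Eo⁺ {v} {e} oe = ∈-filter⁺ (λ e → o e ≟ v) (∈-allFin e) oe

  ∈-Eo⁻ : ∀ {v e} → e ∈ Eo G v → o e ≡ v
  ∈-Eo⁻ {v} e∈ = proj₂ (∈-filter⁻ (λ e → o e ≟ v) {xs = allFin nE} e∈)

  Eo-unique : ∀ v → Unique (Eo G v)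
  Eo-unique v = Unique.filter⁺ (λ e → o e ≟ v) (Unique.allFin⁺ nE)

  ≈M-concatMap : ∀ {A : Set} (g : A → Vertex G) (h : A → List (Vertex G)) (xs : List A) →
    (∀ {x} → x ∈ xs → _≈M_ G [ g x ] (h x)) → _≈M_ G (map g xs) (concatMap h xs)
  ≈M-concatMap g h []       _  = ≈-refl
  ≈M-concatMap g h (x ∷ xs) eq = ≈-++ (eq (here refl)) (≈M-concatMap g h xs (eq ∘ there))

  module Generators (S : Vertex G) (F : List (List (Edge G))) where

    Generated : List (Edge G) → Set
    Generated w = Any (λ x → _≤p_ G x w) F

    generated? : ∀ w → Dec (Generated w)
    generated? w = any? (λ x → prefix? _≟_ x w) F

    GeneratorsWithin : ℕ → List (Edge G) → Set
    GeneratorsWithin n w = ∀ x → x ∈ F → length x ≤ length w + n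

    GeneratorsWithin-∷ʳ : ∀ {n} w e → GeneratorsWithin (suc n) w → GeneratorsWithin n (w ++ [ e ])
    GeneratorsWithin-∷ʳ {n} w e within x x∈F = ≤-trans (within x x∈F) (≤-reflexive (sym (begin
      length (w ++ [ e ]) + n  ≡⟨ cong (_+ n) (length-++ w) ⟩
      length w + 1 + n         ≡⟨ +-assoc (length w) 1 n ⟩
      length w + suc n         ∎)))
      where open ≡-Reasoning

    -- n is fuel: GeneratorsWithin n w ensures it does not run out before the subspace is reached.
    basisFrom : ℕ → List (Edge G) → List (List (Edge G))
    basisFrom zero    w = [ w ]
    basisFrom (suc n) w with generated? w
    ... | yes _ = [ w ]
    ... | no  _ = concatMap (λ e → basisFrom n (w ++ [ e ])) (Eo G (terminus G S w))

    basisFrom-extends : ∀ n w {b} → b ∈ basisFrom n w → _≤p_ G w b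
    basisFrom-extends zero    w (here refl) = [] , sym (++-identityʳ w)
    basisFrom-extends (suc n) w b∈ with generated? w
    basisFrom-extends (suc n) w (here refl) | yes _ = [] , sym (++-identityʳ w)
    ... | no _ with find (∈-concatMap⁻ (λ e → basisFrom n (w ++ [ e ])) {xs = Eo G (terminus G S w)} b∈)
    ...   | e , _ , b∈′ with basisFrom-extends n (w ++ [ e ]) b∈′
    ...     | u , b≡ = e ∷ u , trans b≡ (++-assoc w [ e ] u)

    basisFrom-unique : ∀ n w → Unique (basisFrom n w)
    basisFrom-unique zero    w = [] ∷ []
    basisFrom-unique (suc n) w with generated? w
    ... | yes _ = [] ∷ []
    ... | no  _ = concatMap-unique (λ e → basisFrom n (w ++ [ e ])) (Eo-unique (terminus G S w))
                    (λ e → basisFrom-unique n (w ++ [ e ])) same-edge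
      where
      same-edge : ∀ {e e′ b} → b ∈ basisFrom n (w ++ [ e ]) → b ∈ basisFrom n (w ++ [ e′ ]) → e ≡ e′
      same-edge b∈ b∈′ with basisFrom-extends n _ b∈ | basisFrom-extends n _ b∈′
      ... | u , b≡ | u′ , b≡′ = ∷ʳ-extensions-agree w u u′ (trans (sym b≡) b≡′)

  module CofiniteSubspace {S : Vertex G} {P : List (Edge G) → Set}
           (sub : IsSubspace G S P) (inesc : IsInescapable G S P) (cof : IsCofinite G S P) where

    private
      F : List (List (Edge G))
      F = proj₁ cof

      spans : ∀ w → IsWalkFrom G S w → (P w → ∃ λ x → x ∈ F × _≤p_ G x w) × ((∃ λ x → x ∈ F × _≤p_ G x w) → P w)
      spans = proj₂ (proj₂ cof)

    open Generators S F public

    generated⇒P : ∀ {w} → IsWalkFrom G S w → Generated w → P w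
    generated⇒P {w} walk g = proj₂ (spans w walk) (find g)

    ¬generated⇒¬P : ∀ {w} → IsWalkFrom G S w → ¬ Generated w → ¬ P w
    ¬generated⇒¬P {w} walk ¬g pw =
      let (_ , x∈F , x≤w) = proj₁ (spans w walk) pw in ¬g (lose x∈F x≤w)

    has-out-edge : ∀ {w} → IsWalkFrom G S w → ¬ P w → ∃ λ e → o e ≡ terminus G S w
    has-out-edge {w} walk ¬pw with inesc w walk
    ... | w′ , pw′ , ([] , w′≡w)    = ⊥-elim (¬pw (subst P (trans w′≡w (++-identityʳ w)) pw′))
    ... | w′ , pw′ , (e ∷ u , w′≡w) = e , walk-next-origin w (subst (IsWalkFrom G S) w′≡w (proj₁ sub w′ pw′))

    -- A generator of a P-extension of w is comparable with w, and cannot be longer.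
    long-walk∈P : ∀ {w} → IsWalkFrom G S w → GeneratorsWithin 0 w → P w
    long-walk∈P {w} walk within with inesc w walk
    ... | w′ , pw′ , (_ , w′≡w) with proj₁ (spans w′ (proj₁ sub w′ pw′)) pw′
    ...   | x , x∈F , (_ , w′≡x) with prefixes-comparable x w (trans (sym w′≡x) w′≡w)
    ...     | inj₁ x≤w       = generated⇒P walk (lose x∈F x≤w)
    ...     | inj₂ (q , x≡wq) = generated⇒P walk (lose x∈F ([] , sym (trans (++-identityʳ x) x≡w)))
      where
      x≡w : x ≡ w
      x≡w = trans x≡wq (extension-no-longer w q
        (subst (λ y → length y ≤ length w) x≡wq (≤-trans (within x x∈F) (≤-reflexive (+-identityʳ _)))))

    PrefixMinimal : List (Edge G) → Set
    PrefixMinimal w = ∀ u → P u → _≤p_ G u w → u ≡ w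

    PrefixMinimal-[] : PrefixMinimal []
    PrefixMinimal-[] u _ (r , []≡ur) = ++-conicalˡ u r (sym []≡ur)

    PrefixMinimal-∷ʳ : ∀ {w} e → ¬ P w → PrefixMinimal w → PrefixMinimal (w ++ [ e ])
    PrefixMinimal-∷ʳ {w} e ¬pw minimal u pu (_ , eq) with prefix-of-∷ʳ u w e eq
    ... | inj₁ u≤w = ⊥-elim (¬pw (subst P (minimal u pu u≤w) pu))
    ... | inj₂ u≡  = u≡

    basisFrom-sum : ∀ n {w} → IsWalkFrom G S w →
      _≈M_ G [ terminus G S w ] (map (terminus G S) (basisFrom n w))
    basisFrom-sum zero    walk = ≈-refl
    basisFrom-sum (suc n) {w} walk with generated? w
    ... | yes _ = ≈-refl
    ... | no ¬g = ≈-trans (≈-rel v (has-out-edge walk (¬generated⇒¬P walk ¬g)))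
                    (subst (_≈M_ G (map t (Eo G v))) (sym (map-concatMap (terminus G S) child (Eo G v)))
                      (≈M-concatMap t (map (terminus G S) ∘ child) (Eo G v) child-sum))
      where
      v : Vertex G
      v = terminus G S w
      child : Edge G → List (List (Edge G))
      child e = basisFrom n (w ++ [ e ])
      child-sum : ∀ {e} → e ∈ Eo G v → _≈M_ G [ t e ] (map (terminus G S) (child e))
      child-sum {e} e∈ = subst (λ y → _≈M_ G [ y ] (map (terminus G S) (child e))) (terminus-++ S w [ e ])
                           (basisFrom-sum n (walk-∷ʳ walk (∈-Eo⁻ e∈)))

    basisFrom-sound : ∀ n {w b} → IsWalkFrom G S w → GeneratorsWithin n w → PrefixMinimal w →
      b ∈ basisFrom n w → InBasis G P b
    basisFrom-sound zero walk within minimal (here refl) = long-walk∈P walk within , minimal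
    basisFrom-sound (suc n) {w} walk within minimal b∈ with generated? w
    basisFrom-sound (suc n) walk within minimal (here refl) | yes g = generated⇒P walk g , minimal
    ... | no ¬g with find (∈-concatMap⁻ (λ e → basisFrom n (w ++ [ e ])) {xs = Eo G (terminus G S w)} b∈)
    ...   | e , e∈ , b∈′ = basisFrom-sound n (walk-∷ʳ walk (∈-Eo⁻ e∈)) (GeneratorsWithin-∷ʳ w e within)
                             (PrefixMinimal-∷ʳ e (¬generated⇒¬P walk ¬g) minimal) b∈′

    basisFrom-complete : ∀ n {w b} → IsWalkFrom G S w → GeneratorsWithin n w →
      InBasis G P b → _≤p_ G w b → b ∈ basisFrom n w
    basisFrom-complete zero walk within (_ , minimal) w≤b =
      here (sym (minimal _ (long-walk∈P walk within) w≤b))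
    basisFrom-complete (suc n) {w} walk within b-basis w≤b with generated? w
    ... | yes g = here (sym (proj₂ b-basis _ (generated⇒P walk g) w≤b))
    ... | no ¬g with w≤b
    ...   | [] , b≡w = ⊥-elim (¬generated⇒¬P walk ¬g (subst P (trans b≡w (++-identityʳ w)) (proj₁ b-basis)))
    ...   | e ∷ u , b≡w∷ = ∈-concatMap⁺ (λ e → basisFrom n (w ++ [ e ])) (lose (∈-Eo⁺ oe)
                              (basisFrom-complete n (walk-∷ʳ walk oe) (GeneratorsWithin-∷ʳ w e within) b-basis
                                (u , trans b≡w∷ (sym (++-assoc w [ e ] u)))))
      where
      oe : o e ≡ terminus G S w
      oe = walk-next-origin w (subst (IsWalkFrom G S) b≡w∷ (proj₁ sub _ (proj₁ b-basis)))

lemma13 : (G : Graph) (S : Vertex G) → IsRoot G S →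
    (P : List (Edge G) → Set) →
    IsSubspace G S P → IsInescapable G S P → IsCofinite G S P →
    (B : List (List (Edge G))) → Unique B →
    (∀ w → (w ∈ B → InBasis G P w) × (InBasis G P w → w ∈ B)) →
    _≈M_ G [ S ] (map (terminus G S) B)
lemma13 G S _ P sub inesc cof B B-unique B-basis =
  ≈-trans (basisFrom-sum N ε) (≈-perm (↭-map⁺ (terminus G S) (∼bag⇒↭ L∼B)))
  where
  open CofiniteSubspace G sub inesc cof
  N : ℕ
  N = sum (map length (proj₁ cof))
  L : List (List (Edge G))
  L = basisFrom N []
  within : GeneratorsWithin N []
  within _ x∈F = length≤sum-lengths x∈F
  L⊆B : ∀ {b} → b ∈ L → b ∈ B
  L⊆B b∈L = proj₂ (B-basis _) (basisFrom-sound N ε within PrefixMinimal-[] b∈L)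
  B⊆L : ∀ {b} → b ∈ B → b ∈ L
  B⊆L b∈B = basisFrom-complete N ε within (proj₁ (B-basis _) b∈B) (_ , refl)
  L∼B : L ∼[ bag ] B
  L∼B = unique∧set⇒bag (basisFrom-unique N []) B-unique (mk⇔ L⊆B B⊆L)
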